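{- For all positive integers $n$ and $b$, $P(n,b)\ge b^{n-1}$.
   Context: For an integer $b\ge 1$, the state graph for $b$ balls is the infinite directed graph whose vertices (states) are the infinite $0$-$1$ sequences $\mathbf{c}=\langle c_1,c_2,\ldots\rangle$ (indexed by positive integers) containing exactly $b$ entries equal to $1$, with a directed edge $\mathbf{c}\to\mathbf{d}$ if and only if $d_i\ge c_{i+1}$ for all $i\ge 1$ (loops allowed). $P(n,b)$ denotes the number of directed cycles of length $n$ in this graph (closed walks $v_0\to\cdots\to v_n=v_0$ with $v_0,\ldots,v_{n-1}$ pairwise distinct, identified up to cyclic shift of the starting point); these are the prime juggling patterns of period $n$ with $b$ balls. -}

module Defs where

open import Data.Nat using (ℕ; zero; suc; _+_; _≤_; NonZero; _%_)
open import Data.Nat.DivMod using (m%n<n)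
open import Data.Bool using (Bool; true; false; if_then_else_)
open import Data.Fin using (Fin; toℕ; fromℕ<)
open import Data.Product using (Σ; _×_; ∃)
open import Relation.Binary.PropositionalEquality using (_≡_)

-- A 0-1 sequence ⟨c₁,c₂,…⟩ is modelled as c : ℕ → Bool with  c i  standing for  c_{i+1}
-- (true = 1, false = 0).
Seq : Set
Seq = ℕ → Bool

count : Seq → ℕ → ℕ
count c zero    = 0
count c (suc N) = count c N + (if c N then 1 else 0)

HasBalls : ℕ → Seq → Set
HasBalls b c = Σ ℕ λ N → ((i : ℕ) → N ≤ i → c i ≡ false) × (count c N ≡ b)

-- edge c → d  iff  d_i ≥ c_{i+1} for all i ≥ 1  (0-1 valued: c_{i+1} = 1 ⇒ d_i = 1)
Edge : Seq → Seq → Set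
Edge c d = (i : ℕ) → c (suc i) ≡ true → d i ≡ true

SameState : Seq → Seq → Set
SameState c d = (i : ℕ) → c i ≡ d i

idx : (n : ℕ) → .{{_ : NonZero n}} → ℕ → Fin n
idx n k = fromℕ< (m%n<n k n)

record Cycle (n b : ℕ) .{{_ : NonZero n}} : Set where
  field
    vert     : Fin n → Seq
    balls    : (i : Fin n) → HasBalls b (vert i)
    step     : (k : ℕ) → Edge (vert (idx n k)) (vert (idx n (suc k)))
    distinct : (i j : Fin n) → SameState (vert i) (vert j) → i ≡ j

open Cycle public

SameCycle : (n b : ℕ) .{{_ : NonZero n}} → Cycle n b → Cycle n b → Set
SameCycle n b C D = ∃ λ (s : ℕ) → (i : Fin n) → SameState (vert C (idx n (toℕ i + s))) (vert D i)

-- P(n,b) ≥ m : there are m pairwise non-identified directed cycles of length n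
AtLeastCycles : (n b : ℕ) .{{_ : NonZero n}} → ℕ → Set
AtLeastCycles n b m = Σ (Fin m → Cycle n b) λ f → (i j : Fin m) → SameCycle n b (f i) (f j) → i ≡ j

-- A state with b balls is described by the increasing list p of its ball positions
-- (position i being entry i of the 0-1 sequence).  Read backwards, every configuration
-- p has a predecessor back d p for each d < b: for d = 0 all balls sit one higher (the
-- beat before is empty); for d = 1 + d′ a ball sits at the bottom and ball d′ is missing
-- (the bottom ball is about to be thrown into that slot).  A word e of ν digits gives ν
-- backward steps from config e 0, and the walk is closed by a throw from the bottom to
-- the top: config e 0 = 0 ∷ (suc ∘ config e ν).  This recursion on (ball, beat) is well
-- founded, as ball j + 1 of config e 0 only depends on balls 0, …, j.
-- Because d < b, the top ball rises by exactly one in each backward step, so the ν + 1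
-- states are distinct and a cyclic shift identifying two of these cycles preserves the
-- top height, hence is trivial.  Two consecutive states determine the digit between them,
-- so the b ^ ν words give b ^ ν different cycles.

module Submission where

open import Defs
open import Data.Bool using (Bool; true; false; _∨_; if_then_else_)
open import Data.Bool.Properties using (∨-zeroʳ; ∨-identityʳ)
import Data.Fin as Fin
open import Data.Fin using (Fin; toℕ; fromℕ<; quotient; remainder; combine)
open import Data.Fin.Properties using (toℕ<n; toℕ-fromℕ<; toℕ-injective; combine-remQuot)
open import Data.Nat
open import Data.Nat.DivMod
open import Data.Nat.Divisibility using (m%n≡0⇒n∣m)
open import Data.Nat.Properties
open import Algebra.Properties.CommutativeSemigroup +-commutativeSemigroup using (interchange)
open import Data.Product using (∃; _×_; _,_)
open import Data.Sum using (_⊎_; inj₁; inj₂)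
open import Function using (_∘_)
open import Relation.Binary.Definitions using (tri<; tri≈; tri>)
open import Relation.Binary.PropositionalEquality
open import Relation.Nullary using (does; yes; no; ¬_; contradiction)
open import Relation.Nullary.Decidable using (dec-true; dec-false)

variable
  p q : ℕ → ℕ
  c c′ : Seq
  d d′ i j k m x y z N : ℕ

Increasing : (ℕ → ℕ) → Set
Increasing p = ∀ j → p j < p (suc j)

IncreasingUpTo : ℕ → (ℕ → ℕ) → Set
IncreasingUpTo m p = ∀ j → j ≤ m → p j < p (suc j)

increasing-< : Increasing p → j < k → p j < p k
increasing-< {p} {j} {suc k} p↑ j<1+k with m≤n⇒m<n∨m≡n (≤-pred j<1+k)
... | inj₁ j<k  = <-trans (increasing-< p↑ j<k) (p↑ k)
... | inj₂ refl = p↑ j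

increasing-≤ : Increasing p → j ≤ k → p j ≤ p k
increasing-≤ p↑ j≤k with m≤n⇒m<n∨m≡n j≤k
... | inj₁ j<k  = <⇒≤ (increasing-< p↑ j<k)
... | inj₂ refl = ≤-refl

image : (ℕ → ℕ) → ℕ → Seq
image p zero    i = false
image p (suc m) i = image p m i ∨ does (p m ≟ i)

image-∈ : j < m → image p m (p j) ≡ true
image-∈ {j} {suc m} {p} j<1+m with m≤n⇒m<n∨m≡n (≤-pred j<1+m)
... | inj₁ j<m  rewrite image-∈ {p = p} j<m = refl
... | inj₂ refl = trans (cong (image p m (p m) ∨_) (dec-true (p m ≟ p m) refl)) (∨-zeroʳ _)

image-∋ : image p m i ≡ true → ∃ λ j → j < m × p j ≡ i
image-∋ {p} {suc m} {i} h with image p m i in eq | p m ≟ i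
... | true  | _        = let j , j<m , pj≡i = image-∋ eq in j , m<n⇒m<1+n j<m , pj≡i
... | false | yes pm≡i = m , ≤-refl , pm≡i
... | false | no pm≢i  = contradiction (trans (sym (dec-false (p m ≟ i) pm≢i)) h) λ ()

image-∉ : (∀ j → j < m → p j ≢ i) → image p m i ≡ false
image-∉ {zero}  _ = refl
image-∉ {suc m} {p} {i} h rewrite image-∉ {m} {p} {i} (λ j j<m → h j (m<n⇒m<1+n j<m)) =
  dec-false (p m ≟ i) (h m ≤-refl)

image-below : Increasing p → i < p j → j ≤ m → image p m i ≡ image p j i
image-below {p} {i} {j} {m} p↑ i<pj j≤m with m≤n⇒m<n∨m≡n j≤m
... | inj₂ refl = refl
image-below {p} {i} {j} {suc m} p↑ i<pj j≤m | inj₁ j<1+m = begin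
  image p m i ∨ does (p m ≟ i) ≡⟨ cong (image p m i ∨_) (dec-false (p m ≟ i) pm≢i) ⟩
  image p m i ∨ false          ≡⟨ ∨-identityʳ _ ⟩
  image p m i                  ≡⟨ image-below p↑ i<pj (≤-pred j<1+m) ⟩
  image p j i                  ∎
  where
  open ≡-Reasoning
  pm≢i : p m ≢ i
  pm≢i pm≡i = <⇒≱ i<pj (subst (p j ≤_) pm≡i (increasing-≤ p↑ (≤-pred j<1+m)))

indicator : Bool → ℕ
indicator b = if b then 1 else 0

indicator-∨ : ∀ a b → (a ≡ true → b ≡ false) → indicator (a ∨ b) ≡ indicator a + indicator b
indicator-∨ true  true  h = contradiction (h refl) λ ()
indicator-∨ true  false _ = refl
indicator-∨ false _     _ = refl

count-cong : (∀ i → i < N → c i ≡ c′ i) → count c N ≡ count c′ N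
count-cong {zero}  _    = refl
count-cong {suc N} c≗c′ =
  cong₂ _+_ (count-cong λ i i<N → c≗c′ i (m<n⇒m<1+n i<N)) (cong indicator (c≗c′ N ≤-refl))

count-false : (∀ i → i < N → c i ≡ false) → count c N ≡ 0
count-false {zero}  _ = refl
count-false {suc N} {c} h
  rewrite h N ≤-refl | count-false {N} {c} (λ i i<N → h i (m<n⇒m<1+n i<N)) = refl

count-∨ : (∀ i → c i ≡ true → c′ i ≡ false) → count (λ i → c i ∨ c′ i) N ≡ count c N + count c′ N
count-∨ {N = zero}  _ = refl
count-∨ {c} {c′} {suc N} disjoint = begin
  count (λ i → c i ∨ c′ i) N + indicator (c N ∨ c′ N)
    ≡⟨ cong₂ _+_ (count-∨ {N = N} disjoint) (indicator-∨ (c N) (c′ N) (disjoint N)) ⟩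
  (count c N + count c′ N) + (indicator (c N) + indicator (c′ N))
    ≡⟨ interchange (count c N) (count c′ N) _ _ ⟩
  (count c N + indicator (c N)) + (count c′ N + indicator (c′ N)) ∎
  where open ≡-Reasoning

count-single : x < N → count (λ i → does (x ≟ i)) N ≡ 1
count-single {x} {suc N} x<1+N with m≤n⇒m<n∨m≡n (≤-pred x<1+N)
... | inj₁ x<N  rewrite count-single x<N | dec-false (x ≟ N) (<⇒≢ x<N) = refl
... | inj₂ refl rewrite dec-true (x ≟ x) refl
                      | count-false {x} {λ i → does (x ≟ i)} (λ i i<x → dec-false (x ≟ i) (>⇒≢ i<x)) = refl

count-image : Increasing p → p m ≤ N → count (image p m) N ≡ m
count-image {m = zero} {N} _ _ = count-false {N} λ _ _ → refl
count-image {p} {suc m} {N} p↑ pm≤N = begin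
  count (image p (suc m)) N
    ≡⟨ count-∨ {N = N} disjoint ⟩
  count (image p m) N + count (λ i → does (p m ≟ i)) N
    ≡⟨ cong₂ _+_ (count-image p↑ (<⇒≤ pm<N)) (count-single pm<N) ⟩
  m + 1
    ≡⟨ +-comm m 1 ⟩
  suc m ∎
  where
  open ≡-Reasoning
  pm<N : p m < N
  pm<N = <-≤-trans (p↑ m) pm≤N
  disjoint : ∀ i → image p m i ≡ true → does (p m ≟ i) ≡ false
  disjoint i h = let j , j<m , pj≡i = image-∋ h in
    dec-false (p m ≟ i) λ pm≡i → <⇒≢ (increasing-< p↑ j<m) (trans pj≡i (sym pm≡i))

count-image-rank : Increasing p → j < m → count (image p m) (p j) ≡ j
count-image-rank {p} {j} p↑ j<m =
  trans (count-cong {p j} λ i i<pj → image-below p↑ i<pj (<⇒≤ j<m)) (count-image p↑ ≤-refl)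

image-injective : Increasing p → Increasing q → SameState (image p m) (image q m) → j < m → p j ≡ q j
image-injective {p} {q} {m} {j} p↑ q↑ same j<m
  with image-∋ {q} {m} (trans (sym (same (p j))) (image-∈ j<m))
... | k , k<m , qk≡pj = trans (sym qk≡pj) (cong q k≡j)
  where
  open ≡-Reasoning
  k≡j : k ≡ j
  k≡j = begin
    k                        ≡⟨ count-image-rank q↑ k<m ⟨
    count (image q m) (q k)  ≡⟨ cong (count (image q m)) qk≡pj ⟩
    count (image q m) (p j)  ≡⟨ count-cong {p j} (λ i _ → same i) ⟨
    count (image p m) (p j)  ≡⟨ count-image-rank p↑ j<m ⟩
    j                        ∎

image-hasBalls : Increasing p → HasBalls m (image p m)
image-hasBalls {p} {m} p↑ = p m , beyond , count-image p↑ ≤-refl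
  where
  beyond : ∀ i → p m ≤ i → image p m i ≡ false
  beyond i pm≤i = image-∉ λ j j<m pj≡i → <⇒≱ (increasing-< p↑ j<m) (subst (p m ≤_) (sym pj≡i) pm≤i)

image-edge : (∀ j i → j < m → q j ≡ suc i → ∃ λ k → k < m × p k ≡ i) → Edge (image q m) (image p m)
image-edge {m} {q} {p} lower i qi with image-∋ {q} {m} qi
... | j , j<m , qj≡1+i with lower j i j<m qj≡1+i
...   | k , k<m , pk≡i = subst (λ x → image p m x ≡ true) pk≡i (image-∈ k<m)

pick : ℕ → ℕ → ℕ → ℕ → ℕ
pick j       zero    x y = y
pick zero    (suc d) x y = x
pick (suc j) (suc d) x y = pick j d x y

pick-< : j < d → pick j d x y ≡ x
pick-< {zero}  {suc d} _         = refl
pick-< {suc j} {suc d} (s≤s j<d) = pick-< j<d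

pick-≥ : d ≤ j → pick j d x y ≡ y
pick-≥ {zero}          _         = refl
pick-≥ {suc d} {suc j} (s≤s d≤j) = pick-≥ d≤j

pick-step : x < y → y < z → pick j d x y < pick (suc j) d y z
pick-step {j = j}     {zero}        x<y y<z = y<z
pick-step {j = zero}  {suc zero}    x<y y<z = <-trans x<y y<z
pick-step {j = zero}  {suc (suc d)} x<y y<z = x<y
pick-step {j = suc j} {suc d}       x<y y<z = pick-step {j = j} {d} x<y y<z

-- back d p j reads p only at pred j and j, which lets config below recurse structurally.
backAt : (d j : ℕ) → ℕ → ℕ → ℕ
backAt zero    j       x y = suc y
backAt (suc d) zero    x y = zero
backAt (suc d) (suc j) x y = suc (pick j d x y)

back : ℕ → (ℕ → ℕ) → ℕ → ℕ
back d p j = backAt d j (p (pred j)) (p j)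

back-increasingUpTo : IncreasingUpTo m p → IncreasingUpTo m (back d p)
back-increasingUpTo {d = zero}  p↑ j       j≤m = s≤s (p↑ j j≤m)
back-increasingUpTo {d = suc d} p↑ zero    _   = z<s
back-increasingUpTo {d = suc d} p↑ (suc j) j≤m =
  s≤s (pick-step {j = j} {d} (p↑ j (≤-trans (n≤1+n j) j≤m)) (p↑ (suc j) j≤m))

back-top : d ≤ j → back d p j ≡ suc (p j)
back-top {zero}            _         = refl
back-top {suc d} {suc j}   (s≤s d≤j) = cong suc (pick-≥ d≤j)

back-source : ∀ d p j → back d p j ≡ suc i → ∃ λ k → k ≤ j × p k ≡ i
back-source zero    p j       eq = j , ≤-refl , suc-injective eq
back-source (suc d) p (suc j) eq with j <? d
... | yes j<d = j , n≤1+n j , trans (sym (pick-< j<d)) (suc-injective eq)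
... | no  j≮d = suc j , ≤-refl , trans (sym (pick-≥ (≮⇒≥ j≮d))) (suc-injective eq)

back-separates : Increasing p → (∀ j → j < m → p j ≡ q j) → d < d′ → d′ < m →
                 ¬ (∀ j → j < m → back d p j ≡ back d′ q j)
back-separates {d = zero} {suc d′} _ _ _ d′<m agree = 0≢1+n (sym (agree 0 (≤-<-trans z≤n d′<m)))
back-separates {p} {m} {q} {suc d} {suc d′} p↑ p≗q (s≤s d<d′) d′<m agree =
  <⇒≢ (p↑ d) (suc-injective (sym (begin
    suc (p (suc d))            ≡⟨ cong suc (pick-≥ {d} {d} ≤-refl) ⟨
    back (suc d) p (suc d)     ≡⟨ agree (suc d) (<-trans (s≤s d<d′) d′<m) ⟩
    back (suc d′) q (suc d)    ≡⟨ cong suc (pick-< {d} {d′} d<d′) ⟩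
    suc (q d)                  ≡⟨ cong suc (p≗q d (<-trans (n<1+n d) (<-trans (s≤s d<d′) d′<m))) ⟨
    suc (p d)                  ∎)))
  where open ≡-Reasoning

back-injective : Increasing p → Increasing q → (∀ j → j < m → p j ≡ q j) → d < m → d′ < m →
                 (∀ j → j < m → back d p j ≡ back d′ q j) → d ≡ d′
back-injective {d = d} {d′} p↑ q↑ p≗q d<m d′<m agree with <-cmp d d′
... | tri< d<d′ _ _ = contradiction agree (back-separates p↑ p≗q d<d′ d′<m)
... | tri≈ _ d≡d′ _ = d≡d′
... | tri> _ _ d′<d = contradiction (λ j j<m → sym (agree j j<m))
                        (back-separates q↑ (λ j j<m → sym (p≗q j j<m)) d′<d d<m)

%-suc : ∀ n k .{{_ : NonZero n}} → suc k % n ≡ suc (k % n) % n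
%-suc n k =
  trans (cong (λ x → suc x % n) (m≡m%n+[m/n]*n k n)) ([m+kn]%n≡m%n (suc (k % n)) (k / n) n)

suc-% : ∀ ν k → (k % suc ν < ν × suc k % suc ν ≡ suc (k % suc ν)) ⊎ (k % suc ν ≡ ν × suc k % suc ν ≡ 0)
suc-% ν k with m≤n⇒m<n∨m≡n (≤-pred (m%n<n k (suc ν)))
... | inj₁ r<ν = inj₁ (r<ν , trans (%-suc (suc ν) k) (m<n⇒m%n≡m (s≤s r<ν)))
... | inj₂ r≡ν =
  inj₂ (r≡ν , trans (%-suc (suc ν) k) (trans (cong (λ x → suc x % suc ν) r≡ν) (n%n≡0 (suc ν))))

toℕ-idx : ∀ n k .{{_ : NonZero n}} → toℕ (idx n k) ≡ k % n
toℕ-idx n k = toℕ-fromℕ< (m%n<n k n)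

closedWalk⇒cycle : ∀ {ν b} (w : ℕ → Seq) → (∀ t → HasBalls b (w t)) →
                   (∀ t → t < ν → Edge (w t) (w (suc t))) → Edge (w ν) (w 0) →
                   (∀ s t → s ≤ ν → t ≤ ν → SameState (w s) (w t) → s ≡ t) → Cycle (suc ν) b
closedWalk⇒cycle {ν} {b} w hasBalls forward wrap injective = record
  { vert     = w ∘ toℕ
  ; balls    = hasBalls ∘ toℕ
  ; step     = λ k → subst₂ (λ s t → Edge (w s) (w t))
                 (sym (toℕ-idx (suc ν) k)) (sym (toℕ-idx (suc ν) (suc k))) (walkStep k)
  ; distinct = λ i j same → toℕ-injective (injective _ _ (≤-pred (toℕ<n i)) (≤-pred (toℕ<n j)) same)
  }
  where
  walkStep : ∀ k → Edge (w (k % suc ν)) (w (suc k % suc ν))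
  walkStep k with suc-% ν k
  ... | inj₁ (r<ν , eq) rewrite eq = forward _ r<ν
  ... | inj₂ (r≡ν , eq) rewrite eq | r≡ν = wrap

rotation-trivial : ∀ ν {H H′ s} → (∀ t → t ≤ ν → H + (ν ∸ (t + s) % suc ν) ≡ H′ + (ν ∸ t)) →
                   s % suc ν ≡ 0
rotation-trivial ν {H} {H′} {s} heights =
  ∸-cancelˡ-≡ (≤-pred (m%n<n s (suc ν))) z≤n (≤-antisym (m∸n≤m ν (s % suc ν)) ν≤ν∸r)
  where
  H≤H′ : H ≤ H′
  H≤H′ = ≤-trans (m≤m+n H _)
    (≤-reflexive (trans (heights ν ≤-refl) (trans (cong (H′ +_) (n∸n≡0 ν)) (+-identityʳ H′))))
  ν≤ν∸r : ν ≤ ν ∸ s % suc ν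
  ν≤ν∸r = +-cancelˡ-≤ H ν _ (≤-trans (+-monoˡ-≤ ν H≤H′) (≤-reflexive (sym (heights 0 z≤n))))

digits : ∀ {β} ν → Fin (suc β ^ ν) → ℕ → Fin (suc β)
digits     zero    i r       = Fin.zero
digits {β} (suc ν) i zero    = quotient {suc β} (suc β ^ ν) i
digits {β} (suc ν) i (suc r) = digits ν (remainder {suc β} (suc β ^ ν) i) r

digits-injective : ∀ {β} ν {i j : Fin (suc β ^ ν)} → (∀ r → r < ν → digits ν i r ≡ digits ν j r) → i ≡ j
digits-injective zero {Fin.zero} {Fin.zero} _ = refl
digits-injective {β} (suc ν) {i} {j} agree = begin
  i                          ≡⟨ combine-remQuot {suc β} (suc β ^ ν) i ⟨
  combine (quot i) (rem i)
    ≡⟨ cong₂ combine (agree 0 z<s) (digits-injective ν λ r r<ν → agree (suc r) (s≤s r<ν)) ⟩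
  combine (quot j) (rem j)   ≡⟨ combine-remQuot {suc β} (suc β ^ ν) j ⟩
  j                          ∎
  where
  open ≡-Reasoning
  quot : Fin (suc β ^ suc ν) → Fin (suc β)
  quot = quotient {suc β} (suc β ^ ν)
  rem : Fin (suc β ^ suc ν) → Fin (suc β ^ ν)
  rem = remainder {suc β} (suc β ^ ν)

module Construction (ν β : ℕ) where

  b : ℕ
  b = suc β

  Digits : Set
  Digits = ℕ → Fin b

  config : Digits → ℕ → ℕ → ℕ
  config e zero    zero    = zero
  config e zero    (suc j) = suc (config e ν j)
  config e (suc r) zero    = backAt (toℕ (e r)) zero (config e r zero) (config e r zero)
  config e (suc r) (suc j) = backAt (toℕ (e r)) (suc j) (config e r j) (config e r (suc j))

  config-suc : ∀ e r j → config e (suc r) j ≡ back (toℕ (e r)) (config e r) j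
  config-suc e r zero    = refl
  config-suc e r (suc j) = refl

  config-increasingUpTo : ∀ e m r → IncreasingUpTo m (config e r)
  config-increasingUpTo e zero    zero    zero    _   = z<s
  config-increasingUpTo e (suc m) zero    zero    _   = z<s
  config-increasingUpTo e (suc m) zero    (suc j) j≤m = s≤s (config-increasingUpTo e m ν j (≤-pred j≤m))
  config-increasingUpTo e m       (suc r) j       j≤m rewrite config-suc e r j =
    back-increasingUpTo (config-increasingUpTo e m r) j j≤m

  config-increasing : ∀ e r → Increasing (config e r)
  config-increasing e r j = config-increasingUpTo e j r j ≤-refl

  state : Digits → ℕ → Seq
  state e r = image (config e r) b

  state-hasBalls : ∀ e r → HasBalls b (state e r)
  state-hasBalls e r = image-hasBalls (config-increasing e r)

  state-edge : ∀ e r → Edge (state e (suc r)) (state e r)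
  state-edge e r = image-edge source
    where
    source : ∀ j i → j < b → config e (suc r) j ≡ suc i → ∃ λ k → k < b × config e r k ≡ i
    source j i j<b eq with back-source (toℕ (e r)) (config e r) j (trans (sym (config-suc e r j)) eq)
    ... | k , k≤j , eq′ = k , ≤-<-trans k≤j j<b , eq′

  state-wrap : ∀ e → Edge (state e zero) (state e ν)
  state-wrap e = image-edge source
    where
    source : ∀ j i → j < b → config e zero j ≡ suc i → ∃ λ k → k < b × config e ν k ≡ i
    source (suc j) i j<b eq = j , <-trans (n<1+n j) j<b , suc-injective eq

  height : Digits → ℕ
  height e = config e zero β

  config-top : ∀ e r → config e r β ≡ height e + r
  config-top e zero    = sym (+-identityʳ (height e))
  config-top e (suc r) = begin
    config e (suc r) β              ≡⟨ config-suc e r β ⟩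
    back (toℕ (e r)) (config e r) β ≡⟨ back-top {p = config e r} (≤-pred (toℕ<n (e r))) ⟩
    suc (config e r β)              ≡⟨ cong suc (config-top e r) ⟩
    suc (height e + r)              ≡⟨ +-suc (height e) r ⟨
    height e + suc r                ∎
    where open ≡-Reasoning

  state-injective : ∀ e r e′ r′ → SameState (state e r) (state e′ r′) →
                    ∀ j → j < b → config e r j ≡ config e′ r′ j
  state-injective e r e′ r′ same j = image-injective (config-increasing e r) (config-increasing e′ r′) same

  state-height : ∀ e r e′ r′ → SameState (state e r) (state e′ r′) → height e + r ≡ height e′ + r′
  state-height e r e′ r′ same =
    trans (sym (config-top e r)) (trans (state-injective e r e′ r′ same β ≤-refl) (config-top e′ r′))

  cycle : Digits → Cycle (suc ν) b
  cycle e =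
    closedWalk⇒cycle (λ t → state e (ν ∸ t)) (λ t → state-hasBalls e (ν ∸ t)) forward wrap injective
    where
    forward : ∀ t → t < ν → Edge (state e (ν ∸ t)) (state e (ν ∸ suc t))
    forward t t<ν =
      subst (λ r → Edge (state e r) (state e (ν ∸ suc t)))
        (sym (+-∸-assoc 1 t<ν)) (state-edge e (ν ∸ suc t))
    wrap : Edge (state e (ν ∸ ν)) (state e ν)
    wrap = subst (λ r → Edge (state e r) (state e ν)) (sym (n∸n≡0 ν)) (state-wrap e)
    injective : ∀ s t → s ≤ ν → t ≤ ν → SameState (state e (ν ∸ s)) (state e (ν ∸ t)) → s ≡ t
    injective s t s≤ν t≤ν same =
      ∸-cancelˡ-≡ s≤ν t≤ν (+-cancelˡ-≡ (height e) _ _ (state-height e _ e _ same))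

  cycle-aligned : ∀ {e e′} → SameCycle (suc ν) b (cycle e) (cycle e′) →
                  ∀ r → r ≤ ν → SameState (state e r) (state e′ r)
  cycle-aligned {e} {e′} (s , same) r r≤ν =
    subst₂ (λ x y → SameState (state e x) (state e′ y))
      (trans (cong (ν ∸_) (unrotated ν∸r≤ν)) ν∸[ν∸r]≡r) ν∸[ν∸r]≡r (rotated ν∸r≤ν)
    where
    rotatedᶠ : ∀ i → SameState (state e (ν ∸ (toℕ i + s) % suc ν)) (state e′ (ν ∸ toℕ i))
    rotatedᶠ i = subst (λ x → SameState (state e (ν ∸ x)) (state e′ (ν ∸ toℕ i)))
      (toℕ-idx (suc ν) (toℕ i + s)) (same i)
    rotated : ∀ {t} → t ≤ ν → SameState (state e (ν ∸ (t + s) % suc ν)) (state e′ (ν ∸ t))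
    rotated t≤ν = subst (λ x → SameState (state e (ν ∸ (x + s) % suc ν)) (state e′ (ν ∸ x)))
      (toℕ-fromℕ< (s≤s t≤ν)) (rotatedᶠ (fromℕ< (s≤s t≤ν)))
    s%n≡0 : s % suc ν ≡ 0
    s%n≡0 = rotation-trivial ν λ t t≤ν → state-height e _ e′ _ (rotated t≤ν)
    unrotated : ∀ {t} → t ≤ ν → (t + s) % suc ν ≡ t
    unrotated {t} t≤ν = trans (%-remove-+ʳ t (m%n≡0⇒n∣m s (suc ν) s%n≡0)) (m<n⇒m%n≡m (s≤s t≤ν))
    ν∸r≤ν : ν ∸ r ≤ ν
    ν∸r≤ν = m∸n≤m ν r
    ν∸[ν∸r]≡r : ν ∸ (ν ∸ r) ≡ r
    ν∸[ν∸r]≡r = m∸[m∸n]≡n r≤ν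

  cycle-digits : ∀ {e e′} → SameCycle (suc ν) b (cycle e) (cycle e′) → ∀ r → r < ν → e r ≡ e′ r
  cycle-digits {e} {e′} same r r<ν = toℕ-injective
    (back-injective (config-increasing e r) (config-increasing e′ r) before (toℕ<n (e r)) (toℕ<n (e′ r)) after)
    where
    before : ∀ j → j < b → config e r j ≡ config e′ r j
    before = state-injective e r e′ r (cycle-aligned same r (<⇒≤ r<ν))
    after : ∀ j → j < b → back (toℕ (e r)) (config e r) j ≡ back (toℕ (e′ r)) (config e′ r) j
    after j j<b = begin
      back (toℕ (e r)) (config e r) j
        ≡⟨ config-suc e r j ⟨
      config e (suc r) j
        ≡⟨ state-injective e (suc r) e′ (suc r) (cycle-aligned same (suc r) r<ν) j j<b ⟩
      config e′ (suc r) j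
        ≡⟨ config-suc e′ r j ⟩
      back (toℕ (e′ r)) (config e′ r) j ∎
      where open ≡-Reasoning

proposition4p1 : (n b : ℕ) → .{{_ : NonZero n}} → 1 ≤ b → AtLeastCycles n b (b ^ (n ∸ 1))
proposition4p1 (suc ν) (suc β) _ = cycle ∘ digits ν , λ i j same → digits-injective ν (cycle-digits same)
  where open Construction ν β
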